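{- Let $(n,c)\in\mathbb{N}\times\mathbb{Z}$. There exists a partition $\lambda$ with $(n(\lambda),c(\lambda))=(n,c)$ if and only if $n$ and $c$ have the same parity and $c(2c-1)\le n$. In this case $n=c(2c-1)+2l$ for some $l\in\mathbb{N}$. For any partition $\lambda$ we have $c(\lambda)(2c(\lambda)-1)=n(\lambda)$ if and only if $\lambda=(m,m-1,\dots,2,1)$ for some $m\in\mathbb{N}$. Furthermore, the same statement holds if one restricts to partitions into distinct parts.
   Context: A partition is a finite nonincreasing sequence $\lambda=(a_1\ge a_2\ge\dots\ge a_m)$ of positive integers; the empty sequence is the partition of $0$. Its weight is $n(\lambda)=\sum_i a_i$. Represent $\lambda$ as a left-justified array of boxes, with $a_i$ boxes in the $i$-th row. Label the boxes with $1$ and $-1$ in a chessboard pattern, starting with $1$ in the top-left corner: the box in row $i$ and column $j$ (both starting at $1$) gets label $(-1)^{i+j}$. Let $c(\lambda)$ be the sum of all labels. A partition into distinct parts is one with $a_1>a_2>\dots>a_m$. Here $\mathbb{N}$ includes $0$. -}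

module Defs where

open import Data.Nat using (ℕ; zero; suc; _<_; _>_; _≥_)
open import Data.Integer as ℤ using (ℤ; +_; -_; _+_; _*_; _-_; _≤_)
open import Data.Integer.Divisibility using (_∣_)
open import Data.List using (List; []; _∷_)
open import Data.Nat.ListAction using (sum)
open import Data.List.Relation.Unary.All using (All)
open import Data.List.Relation.Unary.Linked using (Linked)
open import Data.Product using (_×_; ∃; ∃-syntax)
open import Function.Bundles using (_⇔_)
open import Relation.Binary.PropositionalEquality using (_≡_)

IsPartition : List ℕ → Set
IsPartition as = All (λ a → a > 0) as × Linked _≥_ as

IsDistinctPartition : List ℕ → Set
IsDistinctPartition as = All (λ a → a > 0) as × Linked _>_ as

weight : List ℕ → ℕ
weight = sum

sign : ℕ → ℤ
sign zero = + 1
sign (suc zero) = - (+ 1)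
sign (suc (suc k)) = sign k

rowLabels : ℕ → ℕ → ℤ
rowLabels i zero = + 0
rowLabels i (suc a) = rowLabels i a + sign (i Data.Nat.+ suc a)

labelsFrom : ℕ → List ℕ → ℤ
labelsFrom i [] = + 0
labelsFrom i (a ∷ as) = rowLabels i a + labelsFrom (suc i) as

-- c(λ): sum of chessboard labels, box (i,j) (1-based) labelled (-1)^(i+j)
content : List ℕ → ℤ
content = labelsFrom 1

staircase : ℕ → List ℕ
staircase zero = []
staircase (suc m) = suc m ∷ staircase m

f : ℤ → ℤ
f c = c * (+ 2 * c - + 1)

TheoremFor : (List ℕ → Set) → Set
TheoremFor P =
  ( (n : ℕ) (c : ℤ) →
      (∃[ λ' ] (P λ' × weight λ' ≡ n × content λ' ≡ c))
      ⇔ ((+ 2 ∣ (+ n - c)) × f c ≤ + n) )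
  × ( (n : ℕ) (c : ℤ) → (∃[ λ' ] (P λ' × weight λ' ≡ n × content λ' ≡ c)) →
      ∃[ l ] (+ n ≡ f c + + 2 * + l) )
  × ( (λ' : List ℕ) → P λ' →
      (f (content λ') ≡ + weight λ') ⇔ (∃[ m ] (λ' ≡ staircase m)) )

-- Every partition λ arises from a staircase (m, m-1, …, 1), its 2-core, by adding
-- dominoes.  A domino covers one box labelled 1 and one labelled -1, so the content of
-- λ is that of the staircase and its weight exceeds the staircase's by an even number 2l.
-- The staircase of size m has content c with c(2c-1) = m(m+1)/2, its weight; hence
-- n = c(2c-1) + 2l, with l = 0 only for the staircase itself.  Conversely, the contents
-- of staircases run through all of ℤ, and widening the top row of a staircase by 2l
-- gives a partition into distinct parts realising every admissible pair (n, c).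
module Submission where

open import Defs
open import Data.Integer using (ℤ; +_; -_; -[1+_]; _+_; _*_; _-_; _≤_; ∣_∣)
open import Data.Integer.Divisibility using (_∣_; divides)
import Data.Integer.Divisibility.Signed as Signed
import Data.Integer.Properties as ℤₚ
import Data.Integer.Tactic.RingSolver as ℤ-Solver
open import Data.List using (List; []; _∷_)
open import Data.List.Relation.Unary.All using (All; []; _∷_)
open import Data.List.Relation.Unary.Linked as Linked using (Linked; []; [-]; _∷_)
open import Data.Nat as ℕ using (ℕ; zero; suc; z≤n; s≤s; _>_; _≥_)
import Data.Nat.Properties as ℕₚ
import Data.Nat.Tactic.RingSolver as ℕ-Solver
open import Data.Product using (_×_; _,_; ∃₂; ∃-syntax; proj₁; proj₂; map₂)
open import Data.Sum using (_⊎_; inj₁; inj₂)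
open import Function.Base using (id; _∘_)
open import Function.Bundles using (_⇔_; mk⇔; Equivalence)
import Function.Properties.Equivalence as ⇔
open import Relation.Binary.PropositionalEquality
open ≡-Reasoning

sign-suc : ∀ k → sign (suc k) ≡ - sign k
sign-suc zero    = refl
sign-suc (suc k) = trans (sym (ℤₚ.neg-involutive (sign k))) (cong -_ (sym (sign-suc k)))

rowLabels-suc : ∀ i a → rowLabels (suc i) a ≡ - rowLabels i a
rowLabels-suc i zero    = refl
rowLabels-suc i (suc a) =
  trans (cong₂ _+_ (rowLabels-suc i a) (sign-suc (i ℕ.+ suc a)))
        (sym (ℤₚ.neg-distrib-+ (rowLabels i a) _))

labelsFrom-suc : ∀ i as → labelsFrom (suc i) as ≡ - labelsFrom i as
labelsFrom-suc i []       = refl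
labelsFrom-suc i (a ∷ as) =
  trans (cong₂ _+_ (rowLabels-suc i a) (labelsFrom-suc (suc i) as))
        (sym (ℤₚ.neg-distrib-+ (rowLabels i a) _))

rowLabels-2+ : ∀ i a → rowLabels i (2 ℕ.+ a) ≡ rowLabels i a
rowLabels-2+ i a = begin
  rowLabels i a + s + sign (i ℕ.+ suc (suc a))
    ≡⟨ cong (λ t → rowLabels i a + s + t)
            (trans (cong sign (ℕₚ.+-suc i (suc a))) (sign-suc (i ℕ.+ suc a))) ⟩
  rowLabels i a + s - s
    ≡⟨ x+y-y≡x (rowLabels i a) s ⟩
  rowLabels i a ∎
  where
  s : ℤ
  s = sign (i ℕ.+ suc a)
  x+y-y≡x : ∀ x y → x + y - y ≡ x
  x+y-y≡x = ℤ-Solver.solve-∀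

rowLabels-+-even : ∀ i a k → rowLabels i (a ℕ.+ 2 ℕ.* k) ≡ rowLabels i a
rowLabels-+-even i a zero    = cong (rowLabels i) (ℕₚ.+-identityʳ a)
rowLabels-+-even i a (suc k) = begin
  rowLabels i (a ℕ.+ 2 ℕ.* suc k)     ≡⟨ cong (rowLabels i) (rearrange a k) ⟩
  rowLabels i (2 ℕ.+ (a ℕ.+ 2 ℕ.* k)) ≡⟨ rowLabels-2+ i (a ℕ.+ 2 ℕ.* k) ⟩
  rowLabels i (a ℕ.+ 2 ℕ.* k)         ≡⟨ rowLabels-+-even i a k ⟩
  rowLabels i a                       ∎
  where
  rearrange : ∀ a k → a ℕ.+ 2 ℕ.* suc k ≡ 2 ℕ.+ (a ℕ.+ 2 ℕ.* k)
  rearrange = ℕ-Solver.solve-∀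

content-∷ : ∀ a as → content (a ∷ as) ≡ rowLabels 1 a - content as
content-∷ a as = cong (λ t → rowLabels 1 a + t) (labelsFrom-suc 1 as)

content-∷-cong : ∀ a {as bs} → content as ≡ content bs → content (a ∷ as) ≡ content (a ∷ bs)
content-∷-cong a {as} {bs} eq = begin
  content (a ∷ as)          ≡⟨ content-∷ a as ⟩
  rowLabels 1 a - content as ≡⟨ cong (λ t → rowLabels 1 a - t) eq ⟩
  rowLabels 1 a - content bs ≡⟨ content-∷ a bs ⟨
  content (a ∷ bs)          ∎

content-∷-∷ : ∀ a as → content (a ∷ a ∷ as) ≡ content as
content-∷-∷ a as = begin
  content (a ∷ a ∷ as)                       ≡⟨ content-∷ a (a ∷ as) ⟩
  rowLabels 1 a - content (a ∷ as)           ≡⟨ cong (λ t → rowLabels 1 a - t) (content-∷ a as) ⟩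
  rowLabels 1 a - (rowLabels 1 a - content as) ≡⟨ x-[x-y]≡y (rowLabels 1 a) (content as) ⟩
  content as                                 ∎
  where
  x-[x-y]≡y : ∀ x y → x - (x - y) ≡ y
  x-[x-y]≡y = ℤ-Solver.solve-∀

content-∷-2+ : ∀ a as → content (2 ℕ.+ a ∷ as) ≡ content (a ∷ as)
content-∷-2+ a as = cong (_+ labelsFrom 2 as) (rowLabels-2+ 1 a)

parity : ∀ m → ∃[ k ] (m ≡ 2 ℕ.* k ⊎ m ≡ suc (2 ℕ.* k))
parity zero = 0 , inj₁ refl
parity (suc m) with parity m
... | k , inj₁ refl = k , inj₂ refl
... | k , inj₂ refl = suc k , inj₁ (sym (ℕₚ.*-suc 2 k))

content-staircase-even : ∀ k → content (staircase (2 ℕ.* k)) ≡ - + k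
content-staircase-odd  : ∀ k → content (staircase (suc (2 ℕ.* k))) ≡ + suc k

content-staircase-even zero    = refl
content-staircase-even (suc k) = begin
  content (staircase (2 ℕ.* suc k))
    ≡⟨ cong (content ∘ staircase) (ℕₚ.*-suc 2 k) ⟩
  content (staircase (2 ℕ.+ 2 ℕ.* k))
    ≡⟨ content-∷ (2 ℕ.+ 2 ℕ.* k) (staircase (suc (2 ℕ.* k))) ⟩
  rowLabels 1 (2 ℕ.+ 2 ℕ.* k) - content (staircase (suc (2 ℕ.* k)))
    ≡⟨ cong₂ _-_ (rowLabels-+-even 1 2 k) (content-staircase-odd k) ⟩
  - + suc k ∎

content-staircase-odd k = begin
  content (staircase (suc (2 ℕ.* k)))
    ≡⟨ content-∷ (suc (2 ℕ.* k)) (staircase (2 ℕ.* k)) ⟩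
  rowLabels 1 (1 ℕ.+ 2 ℕ.* k) - content (staircase (2 ℕ.* k))
    ≡⟨ cong₂ _-_ (rowLabels-+-even 1 1 k) (content-staircase-even k) ⟩
  + 1 - - + k
    ≡⟨ cong (_+_ (+ 1)) (ℤₚ.neg-involutive (+ k)) ⟩
  + 1 + + k
    ≡⟨ ℤₚ.pos-+ 1 k ⟨
  + suc k ∎

weight-staircase-even : ∀ k → weight (staircase (2 ℕ.* k)) ≡ k ℕ.* suc (2 ℕ.* k)
weight-staircase-odd  : ∀ k → weight (staircase (suc (2 ℕ.* k))) ≡ suc k ℕ.* suc (2 ℕ.* k)

weight-staircase-even zero    = refl
weight-staircase-even (suc k) = begin
  weight (staircase (2 ℕ.* suc k))
    ≡⟨ cong (weight ∘ staircase) (ℕₚ.*-suc 2 k) ⟩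
  2 ℕ.+ 2 ℕ.* k ℕ.+ weight (staircase (suc (2 ℕ.* k)))
    ≡⟨ cong (2 ℕ.+ 2 ℕ.* k ℕ.+_) (weight-staircase-odd k) ⟩
  2 ℕ.+ 2 ℕ.* k ℕ.+ suc k ℕ.* suc (2 ℕ.* k)
    ≡⟨ rearrange k ⟩
  suc k ℕ.* suc (2 ℕ.* suc k) ∎
  where
  rearrange : ∀ k → 2 ℕ.+ 2 ℕ.* k ℕ.+ suc k ℕ.* suc (2 ℕ.* k) ≡ suc k ℕ.* suc (2 ℕ.* suc k)
  rearrange = ℕ-Solver.solve-∀

weight-staircase-odd k = cong (suc (2 ℕ.* k) ℕ.+_) (weight-staircase-even k)

pos-1+2* : ∀ k → + suc (2 ℕ.* k) ≡ + 1 + + 2 * + k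
pos-1+2* k = trans (ℤₚ.pos-+ 1 (2 ℕ.* k)) (cong (_+_ (+ 1)) (ℤₚ.pos-* 2 k))

f-content-staircase : ∀ m → f (content (staircase m)) ≡ + weight (staircase m)
f-content-staircase m with parity m
... | k , inj₁ refl = begin
  f (content (staircase (2 ℕ.* k)))    ≡⟨ cong f (content-staircase-even k) ⟩
  f (- + k)                            ≡⟨ f-neg (+ k) ⟩
  + k * (+ 1 + + 2 * + k)              ≡⟨ cong (+ k *_) (pos-1+2* k) ⟨
  + k * + suc (2 ℕ.* k)                ≡⟨ ℤₚ.pos-* k _ ⟨
  + (k ℕ.* suc (2 ℕ.* k))              ≡⟨ cong +_ (weight-staircase-even k) ⟨
  + weight (staircase (2 ℕ.* k))       ∎
  where
  f-neg : ∀ x → (- x) * (+ 2 * (- x) - + 1) ≡ x * (+ 1 + + 2 * x)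
  f-neg = ℤ-Solver.solve-∀
... | k , inj₂ refl = begin
  f (content (staircase (suc (2 ℕ.* k))))   ≡⟨ cong f (trans (content-staircase-odd k) (ℤₚ.pos-+ 1 k)) ⟩
  f (+ 1 + + k)                             ≡⟨ f-1+ (+ k) ⟩
  (+ 1 + + k) * (+ 1 + + 2 * + k)           ≡⟨ cong₂ _*_ (ℤₚ.pos-+ 1 k) (pos-1+2* k) ⟨
  + suc k * + suc (2 ℕ.* k)                 ≡⟨ ℤₚ.pos-* (suc k) _ ⟨
  + (suc k ℕ.* suc (2 ℕ.* k))               ≡⟨ cong +_ (weight-staircase-odd k) ⟨
  + weight (staircase (suc (2 ℕ.* k)))      ∎
  where
  f-1+ : ∀ x → (+ 1 + x) * (+ 2 * (+ 1 + x) - + 1) ≡ (+ 1 + x) * (+ 1 + + 2 * x)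
  f-1+ = ℤ-Solver.solve-∀

content-staircase-surjective : ∀ c → ∃[ m ] content (staircase m) ≡ c
content-staircase-surjective (+ zero)  = 0 , refl
content-staircase-surjective (+ suc k) = suc (2 ℕ.* k) , content-staircase-odd k
content-staircase-surjective -[1+ k ]  = 2 ℕ.* suc k , content-staircase-even (suc k)

-- staircase m is the 2-core of xs, and l dominoes are removed to reach it.
record HasCore (xs : List ℕ) (m l : ℕ) : Set where
  field
    weight-≡  : weight xs ≡ weight (staircase m) ℕ.+ 2 ℕ.* l
    content-≡ : content xs ≡ content (staircase m)
    rigid     : l ≡ 0 → All (_> 0) xs → xs ≡ staircase m
open HasCore

hasCore-[] : HasCore [] 0 0
hasCore-[] = record { weight-≡ = refl ; content-≡ = refl ; rigid = λ _ _ → refl }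

hasCore-∷-zero : ∀ {xs l} → HasCore xs 0 l → HasCore (0 ∷ xs) 0 l
hasCore-∷-zero {xs} h = record
  { weight-≡  = weight-≡ h
  ; content-≡ = content-∷-cong 0 {xs} {[]} (content-≡ h)
  ; rigid     = λ _ → λ { (() ∷ _) }
  }

hasCore-∷-suc : ∀ {xs m l} → HasCore xs m l → HasCore (suc m ∷ xs) (suc m) l
hasCore-∷-suc {xs} {m} h = record
  { weight-≡  = trans (cong (suc m ℕ.+_) (weight-≡ h)) (sym (ℕₚ.+-assoc (suc m) _ _))
  ; content-≡ = content-∷-cong (suc m) {xs} {staircase m} (content-≡ h)
  ; rigid     = λ { l≡0 (_ ∷ xs>0) → cong (suc m ∷_) (rigid h l≡0 xs>0) }
  }

hasCore-∷-self : ∀ {xs m l} → HasCore xs (suc m) l → HasCore (suc m ∷ xs) m (suc m ℕ.+ l)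
hasCore-∷-self {xs} {m} {l} h = record
  { weight-≡  = trans (cong (suc m ℕ.+_) (weight-≡ h)) (rearrange m (weight (staircase m)) l)
  ; content-≡ = trans (content-∷-cong (suc m) {xs} {staircase (suc m)} (content-≡ h))
                      (content-∷-∷ (suc m) (staircase m))
  ; rigid     = λ ()
  }
  where
  rearrange : ∀ m w l → suc m ℕ.+ (suc m ℕ.+ w ℕ.+ 2 ℕ.* l) ≡ w ℕ.+ 2 ℕ.* (suc m ℕ.+ l)
  rearrange = ℕ-Solver.solve-∀

hasCore-∷-2+ : ∀ {a xs m l} → HasCore (a ∷ xs) m l → HasCore (2 ℕ.+ a ∷ xs) m (suc l)
hasCore-∷-2+ {a} {xs} {m} {l} h = record
  { weight-≡  = trans (cong (2 ℕ.+_) (weight-≡ h)) (rearrange (weight (staircase m)) l)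
  ; content-≡ = trans (content-∷-2+ a xs) (content-≡ h)
  ; rigid     = λ ()
  }
  where
  rearrange : ∀ w l → 2 ℕ.+ (w ℕ.+ 2 ℕ.* l) ≡ w ℕ.+ 2 ℕ.* suc l
  rearrange = ℕ-Solver.solve-∀

CoreBelow : ℕ → List ℕ → Set
CoreBelow b xs = ∃₂ λ m l → m ℕ.≤ b × HasCore xs m l

-- Peeling dominoes off a new row of length d + m leaves a row of length m or m + 1,
-- which shrinks the staircase m to m - 1 or extends it to m + 1.
hasCore-∷-gap : ∀ d {xs m l} → HasCore xs m l → CoreBelow (d ℕ.+ m) (d ℕ.+ m ∷ xs)
hasCore-∷-gap 0 {m = zero}  h = 0 , _ , z≤n , hasCore-∷-zero h
hasCore-∷-gap 0 {m = suc m} h = m , _ , ℕₚ.n≤1+n m , hasCore-∷-self h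
hasCore-∷-gap 1 h = _ , _ , ℕₚ.≤-refl , hasCore-∷-suc h
hasCore-∷-gap (suc (suc d)) h =
  let m′ , l′ , m′≤ , h′ = hasCore-∷-gap d h
  in  m′ , suc l′ , ℕₚ.m≤n⇒m≤o+n 2 m′≤ , hasCore-∷-2+ h′

hasCore-∷ : ∀ {a xs m l} → m ℕ.≤ a → HasCore xs m l → CoreBelow a (a ∷ xs)
hasCore-∷ {a} {xs} {m} m≤a h =
  subst (λ b → CoreBelow b (b ∷ xs)) (ℕₚ.m∸n+n≡m m≤a) (hasCore-∷-gap (a ℕ.∸ m) h)

linked⇒coreBelow : ∀ b xs → Linked _≥_ (b ∷ xs) → CoreBelow b xs
linked⇒coreBelow b []       _           = 0 , 0 , z≤n , hasCore-[]
linked⇒coreBelow b (a ∷ xs) (a≤b ∷ xs↓) =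
  let m , l , m≤a , h     = linked⇒coreBelow a xs xs↓
      m′ , l′ , m′≤a , h′ = hasCore-∷ m≤a h
  in  m′ , l′ , ℕₚ.≤-trans m′≤a a≤b , h′

decreasing⇒hasCore : ∀ {xs} → Linked _≥_ xs → ∃₂ (HasCore xs)
decreasing⇒hasCore {[]}     _   = 0 , 0 , hasCore-[]
decreasing⇒hasCore {a ∷ xs} xs↓ =
  let m , l , _ , h = linked⇒coreBelow a (a ∷ xs) (ℕₚ.≤-refl ∷ xs↓) in m , l , h

weight-hasCore : ∀ {xs m l} → HasCore xs m l → + weight xs ≡ f (content xs) + + 2 * + l
weight-hasCore {xs} {m} {l} h = begin
  + weight xs                                 ≡⟨ cong +_ (weight-≡ h) ⟩
  + (weight (staircase m) ℕ.+ 2 ℕ.* l)        ≡⟨ ℤₚ.pos-+ (weight (staircase m)) (2 ℕ.* l) ⟩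
  + weight (staircase m) + + (2 ℕ.* l)        ≡⟨ cong₂ _+_ (f-content-staircase m) (sym (ℤₚ.pos-* 2 l)) ⟨
  f (content (staircase m)) + + 2 * + l       ≡⟨ cong (λ c → f c + + 2 * + l) (content-≡ h) ⟨
  f (content xs) + + 2 * + l                  ∎

hasCore-rigid : ∀ {xs m l} → HasCore xs m l → All (_> 0) xs →
                f (content xs) ≡ + weight xs → xs ≡ staircase m
hasCore-rigid {xs} {m} {l} h xs>0 f≡weight = rigid h l≡0 xs>0
  where
  w : ℕ
  w = weight (staircase m)
  w+0≡w+2l : w ℕ.+ 0 ≡ w ℕ.+ 2 ℕ.* l
  w+0≡w+2l = ℤₚ.+-injective (begin
    + (w ℕ.+ 0)               ≡⟨ cong +_ (ℕₚ.+-identityʳ w) ⟩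
    + w                       ≡⟨ f-content-staircase m ⟨
    f (content (staircase m)) ≡⟨ cong f (content-≡ h) ⟨
    f (content xs)            ≡⟨ f≡weight ⟩
    + weight xs               ≡⟨ cong +_ (weight-≡ h) ⟩
    + (w ℕ.+ 2 ℕ.* l)         ∎)
  l≡0 : l ≡ 0
  l≡0 = ℕₚ.m+n≡0⇒m≡0 l (sym (ℕₚ.+-cancelˡ-≡ w 0 _ w+0≡w+2l))

widenedStaircase : ℕ → ℕ → List ℕ
widenedStaircase zero    zero    = []
widenedStaircase zero    (suc l) = 2 ℕ.+ 2 ℕ.* l ∷ []
widenedStaircase (suc m) l       = suc m ℕ.+ 2 ℕ.* l ∷ staircase m

staircase-positive : ∀ m → All (_> 0) (staircase m)
staircase-positive zero    = []
staircase-positive (suc m) = s≤s z≤n ∷ staircase-positive m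

staircase-strictlyDecreasing : ∀ m → Linked _>_ (staircase m)
staircase-strictlyDecreasing zero          = []
staircase-strictlyDecreasing (suc zero)    = [-]
staircase-strictlyDecreasing (suc (suc m)) = ℕₚ.≤-refl ∷ staircase-strictlyDecreasing (suc m)

widenedStaircase-distinct : ∀ m l → IsDistinctPartition (widenedStaircase m l)
widenedStaircase-distinct zero          zero    = [] , []
widenedStaircase-distinct zero          (suc l) = s≤s z≤n ∷ [] , [-]
widenedStaircase-distinct (suc zero)    l       = s≤s z≤n ∷ [] , [-]
widenedStaircase-distinct (suc (suc m)) l       =
  s≤s z≤n ∷ staircase-positive (suc m) ,
  ℕₚ.m≤m+n (suc (suc m)) (2 ℕ.* l) ∷ staircase-strictlyDecreasing (suc m)

hasCore-widenedStaircase : ∀ m l → HasCore (widenedStaircase m l) m l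
hasCore-widenedStaircase zero zero = hasCore-[]
hasCore-widenedStaircase zero (suc l) = record
  { weight-≡  = rearrange l
  ; content-≡ = trans (ℤₚ.+-identityʳ _) (rowLabels-+-even 1 2 l)
  ; rigid     = λ ()
  }
  where
  rearrange : ∀ l → 2 ℕ.+ 2 ℕ.* l ℕ.+ 0 ≡ 2 ℕ.* suc l
  rearrange = ℕ-Solver.solve-∀
hasCore-widenedStaircase (suc m) l = record
  { weight-≡  = rearrange m l (weight (staircase m))
  ; content-≡ = cong (_+ labelsFrom 2 (staircase m)) (rowLabels-+-even 1 (suc m) l)
  ; rigid     = λ { refl _ → cong (_∷ staircase m) (ℕₚ.+-identityʳ (suc m)) }
  }
  where
  rearrange : ∀ m l w → suc m ℕ.+ 2 ℕ.* l ℕ.+ w ≡ suc m ℕ.+ w ℕ.+ 2 ℕ.* l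
  rearrange = ℕ-Solver.solve-∀

∃[l]i≡f[c]+2l⇔2∣i-c×f[c]≤i : ∀ i c → (∃[ l ] (i ≡ f c + + 2 * + l)) ⇔ (+ 2 ∣ (i - c) × f c ≤ i)
∃[l]i≡f[c]+2l⇔2∣i-c×f[c]≤i i c = mk⇔ to from
  where
  f[c]-c≡[c*c-c]*2 : ∀ c → c * (+ 2 * c - + 1) - c ≡ (c * c - c) * + 2
  f[c]-c≡[c*c-c]*2 = ℤ-Solver.solve-∀

  to : ∃[ l ] (i ≡ f c + + 2 * + l) → + 2 ∣ (i - c) × f c ≤ i
  to (l , refl) = Signed.∣⇒∣ᵤ (Signed.divides (c * c - c + + l) (identity c (+ l))) ,
                  subst (λ j → f c ≤ f c + j) (ℤₚ.pos-* 2 l) (ℤₚ.i≤i+j (f c) (+ (2 ℕ.* l)))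
    where
    identity : ∀ c l → c * (+ 2 * c - + 1) + + 2 * l - c ≡ (c * c - c + l) * + 2
    identity = ℤ-Solver.solve-∀

  from : + 2 ∣ (i - c) × f c ≤ i → ∃[ l ] (i ≡ f c + + 2 * + l)
  from (2∣i-c , f[c]≤i) =
    let divides l ∣i-f[c]∣≡l*2 = Signed.∣⇒∣ᵤ 2∣i-f[c] in l , (begin
    i                          ≡⟨ split i (f c) ⟩
    f c + (i - f c)            ≡⟨ cong (_+_ (f c)) (ℤₚ.0≤i⇒+∣i∣≡i (ℤₚ.i≤j⇒0≤j-i f[c]≤i)) ⟨
    f c + + ∣ i - f c ∣         ≡⟨ cong (λ e → f c + + e) (trans ∣i-f[c]∣≡l*2 (ℕₚ.*-comm l 2)) ⟩
    f c + + (2 ℕ.* l)          ≡⟨ cong (_+_ (f c)) (ℤₚ.pos-* 2 l) ⟩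
    f c + + 2 * + l            ∎)
    where
    split : ∀ i x → i ≡ x + (i - x)
    split = ℤ-Solver.solve-∀
    difference : ∀ i c x → i - c - (x - c) ≡ i - x
    difference = ℤ-Solver.solve-∀
    2∣i-f[c] : Signed._∣_ (+ 2) (i - f c)
    2∣i-f[c] = subst (Signed._∣_ (+ 2)) (difference i c (f c))
      (Signed.∣m∣n⇒∣m-n (Signed.∣ᵤ⇒∣ {+ 2} {i - c} 2∣i-c) (Signed.divides (c * c - c) (f[c]-c≡[c*c-c]*2 c)))

module _ (P : List ℕ → Set) (P⇒partition : ∀ {xs} → P xs → IsPartition xs)
         (P-widened : ∀ m l → P (widenedStaircase m l)) where

  private
    core : ∀ {xs} → P xs → ∃₂ (HasCore xs)
    core = decreasing⇒hasCore ∘ proj₂ ∘ P⇒partition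

  realisable⇔ : ∀ n c → (∃[ λ' ] (P λ' × weight λ' ≡ n × content λ' ≡ c)) ⇔
                        (∃[ l ] (+ n ≡ f c + + 2 * + l))
  realisable⇔ n c = mk⇔ to from
    where
    to : ∃[ λ' ] (P λ' × weight λ' ≡ n × content λ' ≡ c) → ∃[ l ] (+ n ≡ f c + + 2 * + l)
    to (xs , p , refl , refl) = let _ , l , h = core p in l , weight-hasCore h

    from : ∃[ l ] (+ n ≡ f c + + 2 * + l) → ∃[ λ' ] (P λ' × weight λ' ≡ n × content λ' ≡ c)
    from (l , n≡) with content-staircase-surjective c
    ... | m , refl = widenedStaircase m l , P-widened m l , weight≡n , content-≡ h
      where
      h : HasCore (widenedStaircase m l) m l
      h = hasCore-widenedStaircase m l
      weight≡n : weight (widenedStaircase m l) ≡ n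
      weight≡n = ℤₚ.+-injective (begin
        + weight (widenedStaircase m l)                  ≡⟨ weight-hasCore h ⟩
        f (content (widenedStaircase m l)) + + 2 * + l   ≡⟨ cong (λ c → f c + + 2 * + l) (content-≡ h) ⟩
        f (content (staircase m)) + + 2 * + l            ≡⟨ n≡ ⟨
        + n                                              ∎)

  f[content]≡weight⇒staircase : ∀ {xs} → P xs → f (content xs) ≡ + weight xs → ∃[ m ] (xs ≡ staircase m)
  f[content]≡weight⇒staircase p eq =
    let m , _ , h = core p in m , hasCore-rigid h (proj₁ (P⇒partition p)) eq

  theoremFor : TheoremFor P
  theoremFor =
    (λ n c → ⇔.trans (realisable⇔ n c) (∃[l]i≡f[c]+2l⇔2∣i-c×f[c]≤i (+ n) c)) ,
    (λ n c → Equivalence.to (realisable⇔ n c)) ,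
    λ xs p → mk⇔ (f[content]≡weight⇒staircase p) (λ { (m , refl) → f-content-staircase m })

distinct⇒partition : ∀ {xs} → IsDistinctPartition xs → IsPartition xs
distinct⇒partition = map₂ (Linked.map ℕₚ.<⇒≤)

mainTheorem5 : TheoremFor IsPartition × TheoremFor IsDistinctPartition
mainTheorem5 =
  theoremFor IsPartition id (λ m l → distinct⇒partition (widenedStaircase-distinct m l)) ,
  theoremFor IsDistinctPartition distinct⇒partition widenedStaircase-distinct
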